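{- For all integers $m_1,m_2\ge1$, $$\sum_{k_2\ge1}\sum_{k_1\ge1}\frac{\prod_{i=1}^{m_1}q^{2k_1+2i}}{\prod_{i=0}^{m_1}(1+q^{2k_1+2i+1})}\cdot\frac{\prod_{i=1}^{m_2}q^{2k_1+2k_2+2m_1+2i}}{\prod_{i=0}^{m_2}(1+q^{2k_1+2k_2+2m_1+2i+1})}=\frac{q^{2(m_1+m_2)}\,q^{2m_2}}{(1-q^{2(m_1+m_2)})(1-q^{2m_2})}\cdot\frac{\prod_{i=1}^{m_1+m_2}q^{2i}}{\prod_{i=1}^{m_1+m_2}(1+q^{2i+1})}.$$
   Context: The identity is understood as an identity of formal power series in $q$ (equivalently, of analytic functions for $|q|<1$). -}

module Defs where

-- Formal power series in q with integer coefficients, as coefficient sequences.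

open import Data.Nat as ℕ using (ℕ; zero; suc; _≤_; _∸_)
open import Data.Integer as ℤ using (ℤ; 0ℤ; 1ℤ; -_)
open import Data.Bool using (if_then_else_)
open import Data.List using (List; []; _∷_)
open import Data.Product using (∃-syntax)
open import Relation.Nullary using (does)
open import Relation.Binary.PropositionalEquality using (_≡_)

PS : Set
PS = ℕ → ℤ

sumTo : ℕ → (ℕ → ℤ) → ℤ
sumTo zero    h = h 0
sumTo (suc n) h = sumTo n h ℤ.+ h (suc n)

𝟘 : PS
𝟘 _ = 0ℤ

𝟙 : PS
𝟙 zero    = 1ℤ
𝟙 (suc _) = 0ℤ

q^ : ℕ → PS
q^ a n = if does (n ℕ.≟ a) then 1ℤ else 0ℤ

infixl 6 _⊕_ _⊖_
infixl 7 _⊗_ _⊘_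

_⊕_ : PS → PS → PS
(f ⊕ g) n = f n ℤ.+ g n

_⊖_ : PS → PS → PS
(f ⊖ g) n = f n ℤ.- g n

_⊗_ : PS → PS → PS
(f ⊗ g) n = sumTo n (λ i → f i ℤ.* g (n ∸ i))

-- Multiplicative inverse of a series with constant term 1:
-- g 0 = 1,  g (n+1) = - Σ_{j=1}^{n+1} f j * g (n+1-j).
-- revCoeffs f n = [ g n , g (n-1) , ... , g 0 ].
stepSum : PS → ℕ → List ℤ → ℤ
stepSum f j []       = 0ℤ
stepSum f j (x ∷ xs) = f j ℤ.* x ℤ.+ stepSum f (suc j) xs

revCoeffs : PS → ℕ → List ℤ
revCoeffs f zero    = 1ℤ ∷ []
revCoeffs f (suc n) = (- stepSum f 1 (revCoeffs f n)) ∷ revCoeffs f n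

hd : List ℤ → ℤ
hd []      = 0ℤ
hd (x ∷ _) = x

inv : PS → PS
inv f n = hd (revCoeffs f n)

-- f / g  (only meaningful when g has constant term 1, as in all uses below)
_⊘_ : PS → PS → PS
f ⊘ g = f ⊗ inv g

prodFrom : ℕ → ℕ → (ℕ → PS) → PS
prodFrom lo zero    F = 𝟙
prodFrom lo (suc k) F = F lo ⊗ prodFrom (suc lo) k F

sumFrom : ℕ → ℕ → (ℕ → PS) → PS
sumFrom lo zero    F = 𝟘
sumFrom lo (suc k) F = F lo ⊕ sumFrom (suc lo) k F

-- Σ_{k2 ≥ 1} Σ_{k1 ≥ 1} T k1 k2 = S  in the q-adic (formal power series) topology:
-- each coefficient of the rectangular partial sums over 1 ≤ k1 ≤ K1, 1 ≤ k2 ≤ K2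
-- stabilises at the corresponding coefficient of S.
HasDoubleSum : (ℕ → ℕ → PS) → PS → Set
HasDoubleSum T S =
  ∀ n → ∃[ N ] ∀ K₁ K₂ → N ≤ K₁ → N ≤ K₂ →
    sumFrom 1 K₂ (λ k₂ → sumFrom 1 K₁ (λ k₁ → T k₁ k₂)) n ≡ S n

{-# OPTIONS --safe #-}
-- Write P m a = q^(2am) ∏_{i=1}^m q^(2i) / ∏_{j=a}^{a+m} (1 + q^(2j+1))  (summand m a), so that the
-- double sum is Σ_{k₂} Σ_{k₁} P m₁ k₁ · P m₂ (k₁ + k₂ + m₁).  Because
--   (1 + q^(2(a+m)+1)) - q^(2m) (1 + q^(2a+1)) = 1 - q^(2m),
-- P m telescopes: P m a = G m a - G m (a+1) for
--   G m a = ∏_{i=1}^m q^(2i) / (1 - q^(2m)) · q^(2am) / ∏_{j=a}^{a+m-1} (1 + q^(2j+1))  (antidifference m a).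
-- Summing over k₂ leaves P m₁ k₁ · G m₂ (k₁ + m₁ + 1) = q^(2m₂)/(1 - q^(2m₂)) · P (m₁+m₂) k₁,
-- and summing over k₁ telescopes once more, to q^(2m₂)/(1 - q^(2m₂)) · G (m₁+m₂) 1, the
-- right-hand side.
-- The truncation errors are multiples of G m a, which is divisible by q^a, so every coefficient
-- of the partial sums stabilises.
module Submission where

open import Algebra.Bundles using (CommutativeRing)
import Algebra.Properties.CommutativeSemigroup as CommutativeSemigroupProperties
open import Algebra.Solver.Ring.AlmostCommutativeRing
  using (AlmostCommutativeRing; fromCommutativeRing; _-Raw-AlmostCommutative⟶_)
open import Data.Integer as ℤ using (ℤ; 0ℤ; 1ℤ; -_)
import Data.Integer.Properties as ℤP
open import Data.Integer.Tactic.RingSolver using () renaming (solve-∀ to ℤ-solve-∀)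
open import Data.Maybe as Maybe using ()
open import Data.Nat
  using (ℕ; zero; suc; _+_; _*_; _∸_; _≤_; _<_; _≥_; z≤n; s≤s; NonZero; >-nonZero; >-nonZero⁻¹)
import Data.Nat.Properties as ℕP
open import Data.Nat.Tactic.RingSolver using (solve-∀)
open import Data.Product using (_,_)
open import Defs
open import Level using (0ℓ)
open import Relation.Binary.PropositionalEquality
  using (_≡_; refl; sym; trans; cong; cong₂; subst₂; module ≡-Reasoning)
open import Relation.Binary.Structures using (IsEquivalence)
open import Relation.Nullary.Decidable using (dec⇒maybe)

open CommutativeSemigroupProperties ℤP.+-commutativeSemigroup using () renaming (interchange to +-interchange)

sumTo-cong≤ : ∀ n {h g : ℕ → ℤ} → (∀ i → i ≤ n → h i ≡ g i) → sumTo n h ≡ sumTo n g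
sumTo-cong≤ zero    h≡g = h≡g 0 z≤n
sumTo-cong≤ (suc n) h≡g =
  cong₂ ℤ._+_ (sumTo-cong≤ n (λ i i≤n → h≡g i (ℕP.m≤n⇒m≤1+n i≤n))) (h≡g (suc n) ℕP.≤-refl)

sumTo-cong : ∀ n {h g : ℕ → ℤ} → (∀ i → h i ≡ g i) → sumTo n h ≡ sumTo n g
sumTo-cong n h≡g = sumTo-cong≤ n (λ i _ → h≡g i)

sumTo-zero : ∀ n {h : ℕ → ℤ} → (∀ i → i ≤ n → h i ≡ 0ℤ) → sumTo n h ≡ 0ℤ
sumTo-zero zero    h≡0 = h≡0 0 z≤n
sumTo-zero (suc n) h≡0 =
  cong₂ ℤ._+_ (sumTo-zero n (λ i i≤n → h≡0 i (ℕP.m≤n⇒m≤1+n i≤n))) (h≡0 (suc n) ℕP.≤-refl)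

sumTo-+ : ∀ n (h g : ℕ → ℤ) → sumTo n (λ i → h i ℤ.+ g i) ≡ sumTo n h ℤ.+ sumTo n g
sumTo-+ zero    h g = refl
sumTo-+ (suc n) h g = trans (cong (ℤ._+ (h (suc n) ℤ.+ g (suc n))) (sumTo-+ n h g))
                            (+-interchange (sumTo n h) (sumTo n g) (h (suc n)) (g (suc n)))

*-distribˡ-sumTo : ∀ n c (h : ℕ → ℤ) → c ℤ.* sumTo n h ≡ sumTo n (λ i → c ℤ.* h i)
*-distribˡ-sumTo zero    c h = refl
*-distribˡ-sumTo (suc n) c h = trans (ℤP.*-distribˡ-+ c (sumTo n h) (h (suc n)))
                                     (cong (ℤ._+ c ℤ.* h (suc n)) (*-distribˡ-sumTo n c h))

sumTo-suc : ∀ n (h : ℕ → ℤ) → sumTo (suc n) h ≡ h 0 ℤ.+ sumTo n (λ i → h (suc i))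
sumTo-suc zero    h = refl
sumTo-suc (suc n) h = trans (cong (ℤ._+ h (suc (suc n))) (sumTo-suc n h)) (ℤP.+-assoc (h 0) _ _)

sumTo-reverse : ∀ n (h : ℕ → ℤ) → sumTo n h ≡ sumTo n (λ i → h (n ∸ i))
sumTo-reverse zero    h = refl
sumTo-reverse (suc n) h = begin
  sumTo (suc n) h                               ≡⟨ sumTo-suc n h ⟩
  h 0 ℤ.+ sumTo n (λ i → h (suc i))             ≡⟨ cong (ℤ._+_ (h 0)) (sumTo-reverse n (λ i → h (suc i))) ⟩
  h 0 ℤ.+ sumTo n (λ i → h (suc (n ∸ i)))       ≡⟨ ℤP.+-comm (h 0) _ ⟩
  sumTo n (λ i → h (suc (n ∸ i))) ℤ.+ h 0       ≡⟨ cong₂ ℤ._+_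
                                                      (sumTo-cong≤ n λ i i≤n → cong h (sym (ℕP.+-∸-assoc 1 i≤n)))
                                                      (cong h (sym (ℕP.n∸n≡0 n))) ⟩
  sumTo n (λ i → h (suc n ∸ i)) ℤ.+ h (n ∸ n)   ∎
  where open ≡-Reasoning

infix 4 _≈_
record _≈_ (f g : PS) : Set where
  constructor pointwise
  field at : ∀ n → f n ≡ g n
open _≈_ public

≈-isEquivalence : IsEquivalence _≈_
≈-isEquivalence = record
  { refl  = pointwise λ _ → refl
  ; sym   = λ f≈g → pointwise λ n → sym (at f≈g n)
  ; trans = λ f≈g g≈h → pointwise λ n → trans (at f≈g n) (at g≈h n)
  }

open IsEquivalence ≈-isEquivalence using () renaming (refl to ≈-refl; sym to ≈-sym; trans to ≈-trans)

neg : PS → PS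
neg f n = - f n

tail : PS → PS
tail f n = f (suc n)

⊕-cong : ∀ {f f′ g g′} → f ≈ f′ → g ≈ g′ → f ⊕ g ≈ f′ ⊕ g′
⊕-cong f≈f′ g≈g′ = pointwise λ n → cong₂ ℤ._+_ (at f≈f′ n) (at g≈g′ n)

⊖-cong : ∀ {f f′ g g′} → f ≈ f′ → g ≈ g′ → f ⊖ g ≈ f′ ⊖ g′
⊖-cong f≈f′ g≈g′ = pointwise λ n → cong₂ ℤ._-_ (at f≈f′ n) (at g≈g′ n)

⊗-cong : ∀ {f f′ g g′} → f ≈ f′ → g ≈ g′ → f ⊗ g ≈ f′ ⊗ g′
⊗-cong f≈f′ g≈g′ = pointwise λ n → sumTo-cong n λ i → cong₂ ℤ._*_ (at f≈f′ i) (at g≈g′ (n ∸ i))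

⊗-suc : ∀ f g n → (f ⊗ g) (suc n) ≡ f 0 ℤ.* g (suc n) ℤ.+ (tail f ⊗ g) n
⊗-suc f g n = sumTo-suc n _

⊗-comm : ∀ f g → f ⊗ g ≈ g ⊗ f
⊗-comm f g = pointwise λ n → trans (sumTo-reverse n _) (sumTo-cong≤ n λ i i≤n →
  trans (cong (λ j → f (n ∸ i) ℤ.* g j) (ℕP.m∸[m∸n]≡n i≤n)) (ℤP.*-comm (f (n ∸ i)) (g i)))

⊗-identityˡ : ∀ f → 𝟙 ⊗ f ≈ f
⊗-identityˡ f = pointwise λ where
  zero    → ℤP.*-identityˡ (f 0)
  (suc n) → trans (⊗-suc 𝟙 f n)
    (trans (cong₂ ℤ._+_ (ℤP.*-identityˡ (f (suc n))) (sumTo-zero n λ i _ → ℤP.*-zeroˡ (f (n ∸ i))))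
           (ℤP.+-identityʳ (f (suc n))))

⊗-distribʳ : ∀ h f g → (f ⊕ g) ⊗ h ≈ f ⊗ h ⊕ g ⊗ h
⊗-distribʳ h f g = pointwise λ n →
  trans (sumTo-cong n λ i → ℤP.*-distribʳ-+ (h (n ∸ i)) (f i) (g i)) (sumTo-+ n _ _)

tail-⊗ : ∀ f g h n → (tail (f ⊗ g) ⊗ h) n ≡ f 0 ℤ.* (tail g ⊗ h) n ℤ.+ ((tail f ⊗ g) ⊗ h) n
tail-⊗ f g h n = begin
  sumTo n (λ i → (f ⊗ g) (suc i) ℤ.* h (n ∸ i))
    ≡⟨ sumTo-cong n (λ i → cong (ℤ._* h (n ∸ i)) (⊗-suc f g i)) ⟩
  sumTo n (λ i → (f 0 ℤ.* g (suc i) ℤ.+ (tail f ⊗ g) i) ℤ.* h (n ∸ i))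
    ≡⟨ sumTo-cong n (λ i → distrib (f 0) (g (suc i)) ((tail f ⊗ g) i) (h (n ∸ i))) ⟩
  sumTo n (λ i → f 0 ℤ.* (g (suc i) ℤ.* h (n ∸ i)) ℤ.+ (tail f ⊗ g) i ℤ.* h (n ∸ i))
    ≡⟨ sumTo-+ n _ _ ⟩
  sumTo n (λ i → f 0 ℤ.* (g (suc i) ℤ.* h (n ∸ i))) ℤ.+ ((tail f ⊗ g) ⊗ h) n
    ≡⟨ cong (ℤ._+ ((tail f ⊗ g) ⊗ h) n) (sym (*-distribˡ-sumTo n (f 0) _)) ⟩
  f 0 ℤ.* (tail g ⊗ h) n ℤ.+ ((tail f ⊗ g) ⊗ h) n ∎
  where
  open ≡-Reasoning
  distrib : ∀ a b c d → (a ℤ.* b ℤ.+ c) ℤ.* d ≡ a ℤ.* (b ℤ.* d) ℤ.+ c ℤ.* d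
  distrib = ℤ-solve-∀

⊗-assoc-at : ∀ n f g h → ((f ⊗ g) ⊗ h) n ≡ (f ⊗ (g ⊗ h)) n
⊗-assoc-at zero    f g h = ℤP.*-assoc (f 0) (g 0) (h 0)
⊗-assoc-at (suc n) f g h = begin
  ((f ⊗ g) ⊗ h) (suc n)
    ≡⟨ ⊗-suc (f ⊗ g) h n ⟩
  f 0 ℤ.* g 0 ℤ.* h (suc n) ℤ.+ (tail (f ⊗ g) ⊗ h) n
    ≡⟨ cong (ℤ._+_ (f 0 ℤ.* g 0 ℤ.* h (suc n))) (tail-⊗ f g h n) ⟩
  f 0 ℤ.* g 0 ℤ.* h (suc n) ℤ.+ (f 0 ℤ.* (tail g ⊗ h) n ℤ.+ ((tail f ⊗ g) ⊗ h) n)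
    ≡⟨ cong (λ x → f 0 ℤ.* g 0 ℤ.* h (suc n) ℤ.+ (f 0 ℤ.* (tail g ⊗ h) n ℤ.+ x))
            (⊗-assoc-at n (tail f) g h) ⟩
  f 0 ℤ.* g 0 ℤ.* h (suc n) ℤ.+ (f 0 ℤ.* (tail g ⊗ h) n ℤ.+ (tail f ⊗ (g ⊗ h)) n)
    ≡⟨ regroup (f 0) (g 0) (h (suc n)) ((tail g ⊗ h) n) ((tail f ⊗ (g ⊗ h)) n) ⟩
  f 0 ℤ.* (g 0 ℤ.* h (suc n) ℤ.+ (tail g ⊗ h) n) ℤ.+ (tail f ⊗ (g ⊗ h)) n
    ≡⟨ cong (λ x → f 0 ℤ.* x ℤ.+ (tail f ⊗ (g ⊗ h)) n) (sym (⊗-suc g h n)) ⟩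
  f 0 ℤ.* (g ⊗ h) (suc n) ℤ.+ (tail f ⊗ (g ⊗ h)) n
    ≡⟨ sym (⊗-suc f (g ⊗ h) n) ⟩
  (f ⊗ (g ⊗ h)) (suc n) ∎
  where
  open ≡-Reasoning
  regroup : ∀ a b c x y → a ℤ.* b ℤ.* c ℤ.+ (a ℤ.* x ℤ.+ y) ≡ a ℤ.* (b ℤ.* c ℤ.+ x) ℤ.+ y
  regroup = ℤ-solve-∀

record ConstantTermOne (f : PS) : Set where
  constructor constantTermOne
  field f₀≡1 : f 0 ≡ 1ℤ
open ConstantTermOne

stepSum-revCoeffs : ∀ f n j → stepSum f j (revCoeffs f n) ≡ sumTo n (λ i → f (j + i) ℤ.* inv f (n ∸ i))
stepSum-revCoeffs f zero    j = trans (ℤP.+-identityʳ _) (cong (λ k → f k ℤ.* 1ℤ) (sym (ℕP.+-identityʳ j)))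
stepSum-revCoeffs f (suc n) j = trans
  (cong₂ ℤ._+_ (cong (λ k → f k ℤ.* inv f (suc n)) (sym (ℕP.+-identityʳ j)))
               (trans (stepSum-revCoeffs f n (suc j))
                      (sumTo-cong n λ i → cong (λ k → f k ℤ.* inv f (n ∸ i)) (sym (ℕP.+-suc j i)))))
  (sym (sumTo-suc n _))

inv-inverseʳ : ∀ {f} → ConstantTermOne f → f ⊗ inv f ≈ 𝟙
inv-inverseʳ {f} f₁ = pointwise coefficient
  where
  open ≡-Reasoning
  coefficient : ∀ n → (f ⊗ inv f) n ≡ 𝟙 n
  coefficient zero    = cong (ℤ._* 1ℤ) (f₀≡1 f₁)
  coefficient (suc n) = begin
    (f ⊗ inv f) (suc n)
      ≡⟨ ⊗-suc f (inv f) n ⟩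
    f 0 ℤ.* inv f (suc n) ℤ.+ (tail f ⊗ inv f) n
      ≡⟨ cong₂ (λ a b → a ℤ.* - s ℤ.+ b) (f₀≡1 f₁) (sym (stepSum-revCoeffs f n 1)) ⟩
    1ℤ ℤ.* - s ℤ.+ s
      ≡⟨ cong (ℤ._+ s) (ℤP.*-identityˡ (- s)) ⟩
    - s ℤ.+ s
      ≡⟨ ℤP.+-inverseˡ s ⟩
    0ℤ ∎
    where
    s : ℤ
    s = stepSum f 1 (revCoeffs f n)

PS-commutativeRing : CommutativeRing 0ℓ 0ℓ
PS-commutativeRing = record
  { Carrier = PS ; _≈_ = _≈_ ; _+_ = _⊕_ ; _*_ = _⊗_ ; -_ = neg ; 0# = 𝟘 ; 1# = 𝟙
  ; isCommutativeRing = record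
    { isRing = record
      { +-isAbelianGroup = record
        { isGroup = record
          { isMonoid = record
            { isSemigroup = record
              { isMagma = record { isEquivalence = ≈-isEquivalence ; ∙-cong = ⊕-cong }
              ; assoc   = λ f g h → pointwise λ n → ℤP.+-assoc (f n) (g n) (h n)
              }
            ; identity = (λ f → pointwise λ n → ℤP.+-identityˡ (f n))
                       , (λ f → pointwise λ n → ℤP.+-identityʳ (f n))
            }
          ; inverse = (λ f → pointwise λ n → ℤP.+-inverseˡ (f n))
                    , (λ f → pointwise λ n → ℤP.+-inverseʳ (f n))
          ; ⁻¹-cong = λ f≈g → pointwise λ n → cong -_ (at f≈g n)
          }
        ; comm = λ f g → pointwise λ n → ℤP.+-comm (f n) (g n)
        }
      ; *-cong     = ⊗-cong
      ; *-assoc    = λ f g h → pointwise λ n → ⊗-assoc-at n f g h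
      ; *-identity = ⊗-identityˡ , λ f → ≈-trans (⊗-comm f 𝟙) (⊗-identityˡ f)
      ; distrib    = (λ h f g → ≈-trans (⊗-comm h (f ⊕ g))
                                (≈-trans (⊗-distribʳ h f g) (⊕-cong (⊗-comm f h) (⊗-comm g h))))
                   , ⊗-distribʳ
      }
    ; *-comm = ⊗-comm
    }
  }

PS-almostCommutativeRing : AlmostCommutativeRing 0ℓ 0ℓ
PS-almostCommutativeRing = fromCommutativeRing PS-commutativeRing

open CommutativeRing PS-commutativeRing
  using (setoid; reflexive; +-congˡ; *-congˡ; *-congʳ; *-assoc; *-identityˡ; *-identityʳ; distribˡ; zeroʳ)

infixr 7 _•_
_•_ : ℤ → PS → PS
(c • f) n = c ℤ.* f n

•-⊗ : ∀ c f g → (c • f) ⊗ g ≈ c • (f ⊗ g)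
•-⊗ c f g = pointwise λ n →
  trans (sumTo-cong n λ i → ℤP.*-assoc c (f i) (g (n ∸ i))) (sym (*-distribˡ-sumTo n c _))

-- The solver's constants 0 and 1 must evaluate to 𝟘 and 𝟙 on the nose,
-- so that identities mentioning 𝟙 can be proved by it.
constant : ℤ → PS
constant (ℤ.+ 0) = 𝟘
constant (ℤ.+ 1) = 𝟙
constant c       = c • 𝟙

constant-≈ : ∀ c → constant c ≈ c • 𝟙
constant-≈ (ℤ.+ 0)           = pointwise λ n → sym (ℤP.*-zeroˡ (𝟙 n))
constant-≈ (ℤ.+ 1)           = pointwise λ n → sym (ℤP.*-identityˡ (𝟙 n))
constant-≈ (ℤ.+ suc (suc k)) = ≈-refl
constant-≈ ℤ.-[1+ k ]        = ≈-refl

constant-homomorphism : ℤ.+-*-rawRing -Raw-AlmostCommutative⟶ PS-almostCommutativeRing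
constant-homomorphism = record
  { ⟦_⟧    = constant
  ; +-homo = λ a b → pointwise λ n → trans (at (constant-≈ (a ℤ.+ b)) n)
      (trans (ℤP.*-distribʳ-+ (𝟙 n) a b) (sym (cong₂ ℤ._+_ (at (constant-≈ a) n) (at (constant-≈ b) n))))
  ; *-homo = λ a b → ≈-trans (constant-≈ (a ℤ.* b)) (≈-sym (begin
      constant a ⊗ constant b ≈⟨ ⊗-cong (constant-≈ a) (constant-≈ b) ⟩
      (a • 𝟙) ⊗ (b • 𝟙)       ≈⟨ •-⊗ a 𝟙 (b • 𝟙) ⟩
      a • (𝟙 ⊗ (b • 𝟙))       ≈⟨ pointwise (λ n → cong (a ℤ.*_) (at (⊗-identityˡ (b • 𝟙)) n)) ⟩
      a • b • 𝟙               ≈⟨ pointwise (λ n → sym (ℤP.*-assoc a b (𝟙 n))) ⟩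
      (a ℤ.* b) • 𝟙           ∎))
  ; -‿homo = λ a → pointwise λ n → trans (at (constant-≈ (- a)) n)
      (trans (sym (ℤP.neg-distribˡ-* a (𝟙 n))) (cong -_ (sym (at (constant-≈ a) n))))
  ; 0-homo = ≈-refl
  ; 1-homo = ≈-refl
  }
  where open import Relation.Binary.Reasoning.Setoid setoid

open import Algebra.Solver.Ring ℤ.+-*-rawRing PS-almostCommutativeRing constant-homomorphism
  (λ a b → Maybe.map (λ a≡b → reflexive (cong constant a≡b)) (dec⇒maybe (a ℤ.≟ b)))
  using (solve; _:=_; _:+_; _:*_; _:-_; con)

open import Relation.Binary.Reasoning.Setoid setoid

shift : PS → PS
shift f zero    = 0ℤ
shift f (suc n) = f n

shift-cong : ∀ {f g} → f ≈ g → shift f ≈ shift g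
shift-cong f≈g = pointwise λ where
  zero    → refl
  (suc n) → at f≈g n

shift-⊗ : ∀ f g → shift f ⊗ g ≈ shift (f ⊗ g)
shift-⊗ f g = pointwise λ where
  zero    → ℤP.*-zeroˡ (g 0)
  (suc n) → trans (⊗-suc (shift f) g n)
                  (trans (cong (ℤ._+ (f ⊗ g) n) (ℤP.*-zeroˡ (g (suc n)))) (ℤP.+-identityˡ _))

q^-zero : q^ 0 ≈ 𝟙
q^-zero = pointwise λ where
  zero    → refl
  (suc n) → refl

q^-suc : ∀ a → q^ (suc a) ≈ shift (q^ a)
q^-suc a = pointwise λ where
  zero    → refl
  (suc n) → refl

q^-+ : ∀ a b → q^ a ⊗ q^ b ≈ q^ (a + b)
q^-+ zero    b = ≈-trans (*-congʳ {q^ b} q^-zero) (⊗-identityˡ (q^ b))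
q^-+ (suc a) b = begin
  q^ (suc a) ⊗ q^ b     ≈⟨ *-congʳ {q^ b} (q^-suc a) ⟩
  shift (q^ a) ⊗ q^ b   ≈⟨ shift-⊗ (q^ a) (q^ b) ⟩
  shift (q^ a ⊗ q^ b)   ≈⟨ shift-cong (q^-+ a b) ⟩
  shift (q^ (a + b))    ≈⟨ ≈-sym (q^-suc (a + b)) ⟩
  q^ (suc a + b)        ∎

q^-cong : ∀ {a b} → a ≡ b → q^ a ≈ q^ b
q^-cong a≡b = reflexive (cong q^ a≡b)

q^-vanishes : ∀ a n → n < a → q^ a n ≡ 0ℤ
q^-vanishes (suc a) zero    _         = refl
q^-vanishes (suc a) (suc n) (s≤s n<a) = q^-vanishes a n n<a

constantTermOne-⊗ : ∀ {f g} → ConstantTermOne f → ConstantTermOne g → ConstantTermOne (f ⊗ g)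
constantTermOne-⊗ f₁ g₁ = constantTermOne (cong₂ ℤ._*_ (f₀≡1 f₁) (f₀≡1 g₁))

constantTermOne-prodFrom : ∀ lo len (F : ℕ → PS) → (∀ i → ConstantTermOne (F i)) →
                           ConstantTermOne (prodFrom lo len F)
constantTermOne-prodFrom lo zero      F F₁ = constantTermOne refl
constantTermOne-prodFrom lo (suc len) F F₁ = constantTermOne-⊗ (F₁ lo) (constantTermOne-prodFrom (suc lo) len F F₁)

constantTermOne-𝟙⊕q^ : ∀ a → 0 < a → ConstantTermOne (𝟙 ⊕ q^ a)
constantTermOne-𝟙⊕q^ a 0<a = constantTermOne (cong (ℤ._+_ 1ℤ) (q^-vanishes a 0 0<a))

constantTermOne-𝟙⊖q^ : ∀ a → 0 < a → ConstantTermOne (𝟙 ⊖ q^ a)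
constantTermOne-𝟙⊖q^ a 0<a = constantTermOne (cong (ℤ._-_ 1ℤ) (q^-vanishes a 0 0<a))

inv-inverseˡ : ∀ {f} → ConstantTermOne f → inv f ⊗ f ≈ 𝟙
inv-inverseˡ {f} f₁ = ≈-trans (⊗-comm (inv f) f) (inv-inverseʳ f₁)

inv-unique : ∀ {f} g → ConstantTermOne f → g ⊗ f ≈ 𝟙 → g ≈ inv f
inv-unique {f} g f₁ g⊗f≈𝟙 = begin
  g                ≈⟨ ≈-sym (*-identityʳ g) ⟩
  g ⊗ 𝟙            ≈⟨ *-congˡ {g} (≈-sym (inv-inverseʳ f₁)) ⟩
  g ⊗ (f ⊗ inv f)  ≈⟨ ≈-sym (*-assoc g f (inv f)) ⟩
  (g ⊗ f) ⊗ inv f  ≈⟨ *-congʳ {inv f} g⊗f≈𝟙 ⟩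
  𝟙 ⊗ inv f        ≈⟨ *-identityˡ (inv f) ⟩
  inv f            ∎

inv-cong : ∀ {f g} → ConstantTermOne f → f ≈ g → inv f ≈ inv g
inv-cong {f} {g} f₁ f≈g = inv-unique (inv f) g₁ (≈-trans (*-congˡ {inv f} (≈-sym f≈g)) (inv-inverseˡ f₁))
  where
  g₁ : ConstantTermOne g
  g₁ = constantTermOne (trans (sym (at f≈g 0)) (f₀≡1 f₁))

inv-⊗ : ∀ {f g} → ConstantTermOne f → ConstantTermOne g → inv (f ⊗ g) ≈ inv f ⊗ inv g
inv-⊗ {f} {g} f₁ g₁ = ≈-sym (inv-unique (inv f ⊗ inv g) (constantTermOne-⊗ f₁ g₁) (begin
  (inv f ⊗ inv g) ⊗ (f ⊗ g)  ≈⟨ solve 4 (λ f′ g′ f g → (f′ :* g′) :* (f :* g) := (f′ :* f) :* (g′ :* g))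
                                        ≈-refl (inv f) (inv g) f g ⟩
  (inv f ⊗ f) ⊗ (inv g ⊗ g)  ≈⟨ ⊗-cong (inv-inverseˡ f₁) (inv-inverseˡ g₁) ⟩
  𝟙 ⊗ 𝟙                      ≈⟨ *-identityˡ 𝟙 ⟩
  𝟙                          ∎))

inv-≈-⊘ : ∀ {x z} y → ConstantTermOne x → ConstantTermOne z → x ⊗ y ≈ z → inv x ≈ y ⊘ z
inv-≈-⊘ {x} {z} y x₁ z₁ x⊗y≈z = ≈-sym (inv-unique (y ⊘ z) x₁ (begin
  (y ⊗ inv z) ⊗ x  ≈⟨ solve 3 (λ y z′ x → (y :* z′) :* x := (x :* y) :* z′) ≈-refl y (inv z) x ⟩
  (x ⊗ y) ⊗ inv z  ≈⟨ *-congʳ {inv z} x⊗y≈z ⟩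
  z ⊗ inv z        ≈⟨ inv-inverseʳ z₁ ⟩
  𝟙                ∎))

prodFrom-reindex : ∀ len lo lo′ (F G : ℕ → PS) → (∀ i → F (i + lo) ≈ G (i + lo′)) →
                   prodFrom lo len F ≈ prodFrom lo′ len G
prodFrom-reindex zero      lo lo′ F G F≈G = ≈-refl
prodFrom-reindex (suc len) lo lo′ F G F≈G = ⊗-cong (F≈G 0) (prodFrom-reindex len (suc lo) (suc lo′) F G λ i →
  subst₂ (λ j j′ → F j ≈ G j′) (sym (ℕP.+-suc i lo)) (sym (ℕP.+-suc i lo′)) (F≈G (suc i)))

prodFrom-+ : ∀ a b lo (F : ℕ → PS) → prodFrom lo (a + b) F ≈ prodFrom lo a F ⊗ prodFrom (a + lo) b F
prodFrom-+ zero    b lo F = ≈-sym (*-identityˡ (prodFrom lo b F))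
prodFrom-+ (suc a) b lo F = begin
  F lo ⊗ prodFrom (suc lo) (a + b) F      ≈⟨ *-congˡ {F lo} (prodFrom-+ a b (suc lo) F) ⟩
  F lo ⊗ (P ⊗ prodFrom (a + suc lo) b F)  ≈⟨ ≈-sym (*-assoc (F lo) P (prodFrom (a + suc lo) b F)) ⟩
  (F lo ⊗ P) ⊗ prodFrom (a + suc lo) b F  ≡⟨ cong (λ k → (F lo ⊗ P) ⊗ prodFrom k b F) (ℕP.+-suc a lo) ⟩
  (F lo ⊗ P) ⊗ prodFrom (suc a + lo) b F  ∎
  where
  P : PS
  P = prodFrom (suc lo) a F

prodFrom-q^ : ∀ len lo c (h : ℕ → ℕ) →
              prodFrom lo len (λ i → q^ (c + h i)) ≈ q^ (len * c) ⊗ prodFrom lo len (λ i → q^ (h i))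
prodFrom-q^ zero      lo c h = ≈-sym (≈-trans (*-congʳ {𝟙} q^-zero) (*-identityˡ 𝟙))
prodFrom-q^ (suc len) lo c h = begin
  q^ (c + h lo) ⊗ prodFrom (suc lo) len (λ i → q^ (c + h i))
    ≈⟨ ⊗-cong (≈-sym (q^-+ c (h lo))) (prodFrom-q^ len (suc lo) c h) ⟩
  (q^ c ⊗ q^ (h lo)) ⊗ (q^ (len * c) ⊗ P)
    ≈⟨ solve 4 (λ a b c d → (a :* b) :* (c :* d) := (a :* c) :* (b :* d)) ≈-refl (q^ c) (q^ (h lo)) (q^ (len * c)) P ⟩
  (q^ c ⊗ q^ (len * c)) ⊗ (q^ (h lo) ⊗ P)
    ≈⟨ *-congʳ {q^ (h lo) ⊗ P} (q^-+ c (len * c)) ⟩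
  q^ (c + len * c) ⊗ (q^ (h lo) ⊗ P) ∎
  where
  P : PS
  P = prodFrom (suc lo) len (λ i → q^ (h i))

sumFrom-cong : ∀ lo len {F G} → (∀ i → F i ≈ G i) → sumFrom lo len F ≈ sumFrom lo len G
sumFrom-cong lo zero      F≈G = ≈-refl
sumFrom-cong lo (suc len) F≈G = ⊕-cong (F≈G lo) (sumFrom-cong (suc lo) len F≈G)

sumFrom-reindex : ∀ len lo lo′ (F G : ℕ → PS) → (∀ i → F (i + lo) ≈ G (i + lo′)) →
                  sumFrom lo len F ≈ sumFrom lo′ len G
sumFrom-reindex zero      lo lo′ F G F≈G = ≈-refl
sumFrom-reindex (suc len) lo lo′ F G F≈G = ⊕-cong (F≈G 0) (sumFrom-reindex len (suc lo) (suc lo′) F G λ i →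
  subst₂ (λ j j′ → F j ≈ G j′) (sym (ℕP.+-suc i lo)) (sym (ℕP.+-suc i lo′)) (F≈G (suc i)))

sumFrom-⊕ : ∀ lo len (F G : ℕ → PS) →
            sumFrom lo len (λ i → F i ⊕ G i) ≈ sumFrom lo len F ⊕ sumFrom lo len G
sumFrom-⊕ lo zero      F G = pointwise λ n → sym (ℤP.+-identityʳ 0ℤ)
sumFrom-⊕ lo (suc len) F G = begin
  (F lo ⊕ G lo) ⊕ sumFrom (suc lo) len (λ i → F i ⊕ G i)
    ≈⟨ +-congˡ {F lo ⊕ G lo} (sumFrom-⊕ (suc lo) len F G) ⟩
  (F lo ⊕ G lo) ⊕ (sumFrom (suc lo) len F ⊕ sumFrom (suc lo) len G)
    ≈⟨ solve 4 (λ a b c d → (a :+ b) :+ (c :+ d) := (a :+ c) :+ (b :+ d)) ≈-refl (F lo) (G lo) _ _ ⟩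
  (F lo ⊕ sumFrom (suc lo) len F) ⊕ (G lo ⊕ sumFrom (suc lo) len G) ∎

sumFrom-⊖ : ∀ lo len (F G : ℕ → PS) →
            sumFrom lo len (λ i → F i ⊖ G i) ≈ sumFrom lo len F ⊖ sumFrom lo len G
sumFrom-⊖ lo zero      F G = pointwise λ n → sym (ℤP.+-identityʳ 0ℤ)
sumFrom-⊖ lo (suc len) F G = begin
  (F lo ⊖ G lo) ⊕ sumFrom (suc lo) len (λ i → F i ⊖ G i)
    ≈⟨ +-congˡ {F lo ⊖ G lo} (sumFrom-⊖ (suc lo) len F G) ⟩
  (F lo ⊖ G lo) ⊕ (sumFrom (suc lo) len F ⊖ sumFrom (suc lo) len G)
    ≈⟨ solve 4 (λ a b c d → (a :- b) :+ (c :- d) := (a :+ c) :- (b :+ d)) ≈-refl (F lo) (G lo) _ _ ⟩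
  (F lo ⊕ sumFrom (suc lo) len F) ⊖ (G lo ⊕ sumFrom (suc lo) len G) ∎

sumFrom-swap : ∀ lo lo′ len len′ (H : ℕ → ℕ → PS) →
  sumFrom lo len (λ j → sumFrom lo′ len′ (λ i → H i j))
    ≈ sumFrom lo′ len′ (λ i → sumFrom lo len (λ j → H i j))
sumFrom-swap lo lo′ zero      len′ H = ≈-sym (sumFrom-zero lo′ len′)
  where
  sumFrom-zero : ∀ lo len → sumFrom lo len (λ _ → 𝟘) ≈ 𝟘
  sumFrom-zero lo zero      = ≈-refl
  sumFrom-zero lo (suc len) = pointwise λ n → trans (ℤP.+-identityˡ _) (at (sumFrom-zero (suc lo) len) n)
sumFrom-swap lo lo′ (suc len) len′ H = begin
  sumFrom lo′ len′ (λ i → H i lo) ⊕ sumFrom (suc lo) len (λ j → sumFrom lo′ len′ (λ i → H i j))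
    ≈⟨ +-congˡ {sumFrom lo′ len′ (λ i → H i lo)} (sumFrom-swap (suc lo) lo′ len len′ H) ⟩
  sumFrom lo′ len′ (λ i → H i lo) ⊕ sumFrom lo′ len′ (λ i → sumFrom (suc lo) len (λ j → H i j))
    ≈⟨ ≈-sym (sumFrom-⊕ lo′ len′ _ _) ⟩
  sumFrom lo′ len′ (λ i → H i lo ⊕ sumFrom (suc lo) len (λ j → H i j)) ∎

sumFrom-*ˡ : ∀ lo len c (F : ℕ → PS) → sumFrom lo len (λ i → c ⊗ F i) ≈ c ⊗ sumFrom lo len F
sumFrom-*ˡ lo zero      c F = ≈-sym (zeroʳ c)
sumFrom-*ˡ lo (suc len) c F = ≈-trans (+-congˡ {c ⊗ F lo} (sumFrom-*ˡ (suc lo) len c F))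
                                      (≈-sym (distribˡ c (F lo) (sumFrom (suc lo) len F)))

sumFrom-telescope : ∀ lo len (G : ℕ → PS) → sumFrom lo len (λ k → G k ⊖ G (suc k)) ≈ G lo ⊖ G (len + lo)
sumFrom-telescope lo zero      G = pointwise λ n → sym (ℤP.+-inverseʳ (G lo n))
sumFrom-telescope lo (suc len) G = begin
  (G lo ⊖ G (suc lo)) ⊕ sumFrom (suc lo) len (λ k → G k ⊖ G (suc k))
    ≈⟨ +-congˡ {G lo ⊖ G (suc lo)} (sumFrom-telescope (suc lo) len G) ⟩
  (G lo ⊖ G (suc lo)) ⊕ (G (suc lo) ⊖ G (len + suc lo))
    ≈⟨ solve 3 (λ a b c → (a :- b) :+ (b :- c) := a :- c) ≈-refl (G lo) (G (suc lo)) (G (len + suc lo)) ⟩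
  G lo ⊖ G (len + suc lo)
    ≡⟨ cong (λ k → G lo ⊖ G k) (ℕP.+-suc len lo) ⟩
  G lo ⊖ G (suc len + lo) ∎

VanishesBelow : ℕ → PS → Set
VanishesBelow N f = ∀ n → n < N → f n ≡ 0ℤ

q^-vanishesBelow : ∀ {N} a → N ≤ a → VanishesBelow N (q^ a)
q^-vanishesBelow a N≤a n n<N = q^-vanishes a n (ℕP.<-≤-trans n<N N≤a)

vanishesBelow-⊗ˡ : ∀ {N f} g → VanishesBelow N f → VanishesBelow N (f ⊗ g)
vanishesBelow-⊗ˡ g f≈0 n n<N =
  sumTo-zero n λ i i≤n →
    trans (cong (ℤ._* g (n ∸ i)) (f≈0 i (ℕP.≤-<-trans i≤n n<N))) (ℤP.*-zeroˡ (g (n ∸ i)))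

vanishesBelow-⊗ʳ : ∀ {N g} f → VanishesBelow N g → VanishesBelow N (f ⊗ g)
vanishesBelow-⊗ʳ {g = g} f g≈0 n n<N = trans (at (⊗-comm f g) n) (vanishesBelow-⊗ˡ f g≈0 n n<N)

vanishesBelow-sumFrom : ∀ {N} lo len (G : ℕ → PS) → (∀ k → VanishesBelow N (G k)) →
                        VanishesBelow N (sumFrom lo len G)
vanishesBelow-sumFrom lo zero      G G≈0 n n<N = refl
vanishesBelow-sumFrom lo (suc len) G G≈0 n n<N =
  cong₂ ℤ._+_ (G≈0 lo n n<N) (vanishesBelow-sumFrom (suc lo) len G G≈0 n n<N)

⊖-vanishesBelow : ∀ {N g} f → VanishesBelow N g → ∀ {n} → n < N → (f ⊖ g) n ≡ f n
⊖-vanishesBelow f g≈0 {n} n<N = trans (cong (ℤ._-_ (f n)) (g≈0 n n<N)) (ℤP.+-identityʳ (f n))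

⊗-distribˡ-⊖ : ∀ f g h → f ⊗ (g ⊖ h) ≈ f ⊗ g ⊖ f ⊗ h
⊗-distribˡ-⊖ = solve 3 (λ f g h → f :* (g :- h) := f :* g :- f :* h) ≈-refl

oddFactor : ℕ → PS
oddFactor j = 𝟙 ⊕ q^ (2 * j + 1)

oddProduct : ℕ → ℕ → PS
oddProduct a len = prodFrom a len oddFactor

evenProduct : ℕ → PS
evenProduct m = prodFrom 1 m (λ i → q^ (2 * i))

summand : ℕ → ℕ → PS
summand m a = (q^ (2 * a * m) ⊗ evenProduct m) ⊘ oddProduct a (suc m)

ratio : ℕ → ℕ → PS
ratio m a = q^ (2 * a * m) ⊘ oddProduct a m

antidifference : ℕ → ℕ → PS
antidifference m a = (evenProduct m ⊘ (𝟙 ⊖ q^ (2 * m))) ⊗ ratio m a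

geometric : ℕ → PS
geometric m = q^ (2 * m) ⊘ (𝟙 ⊖ q^ (2 * m))

constantTermOne-oddProduct : ∀ a len → ConstantTermOne (oddProduct a len)
constantTermOne-oddProduct a len =
  constantTermOne-prodFrom a len oddFactor λ j → constantTermOne-𝟙⊕q^ (2 * j + 1) (ℕP.m≤n+m 1 (2 * j))

constantTermOne-𝟙⊖q^2m : ∀ m .{{_ : NonZero m}} → ConstantTermOne (𝟙 ⊖ q^ (2 * m))
constantTermOne-𝟙⊖q^2m m = constantTermOne-𝟙⊖q^ (2 * m) (ℕP.m<n⇒m<o*n 2 (>-nonZero⁻¹ m))

summand-≈ : ∀ m a b → b ≡ 2 * a →
  prodFrom 1 m (λ i → q^ (b + 2 * i)) ⊘ prodFrom 0 (m + 1) (λ i → 𝟙 ⊕ q^ (b + 2 * i + 1)) ≈ summand m a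
summand-≈ m a b b≡2a = ⊗-cong numerator (inv-cong D-constantTermOne denominator)
  where
  numerator : prodFrom 1 m (λ i → q^ (b + 2 * i)) ≈ q^ (2 * a * m) ⊗ evenProduct m
  numerator = ≈-trans (prodFrom-q^ m 1 b (2 *_))
                      (*-congʳ {evenProduct m} (q^-cong (trans (cong (m *_) b≡2a) (ℕP.*-comm m (2 * a)))))
  exponent : ∀ i → b + 2 * (i + 0) + 1 ≡ 2 * (i + a) + 1
  exponent i = trans (cong (λ c → c + 2 * (i + 0) + 1) b≡2a) (shuffle a i)
    where
    shuffle : ∀ a i → 2 * a + 2 * (i + 0) + 1 ≡ 2 * (i + a) + 1
    shuffle = solve-∀
  D : ℕ → PS
  D i = 𝟙 ⊕ q^ (b + 2 * i + 1)
  D-constantTermOne : ConstantTermOne (prodFrom 0 (m + 1) D)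
  D-constantTermOne = constantTermOne-prodFrom 0 (m + 1) D λ i → constantTermOne-𝟙⊕q^ _ (ℕP.m≤n+m 1 (b + 2 * i))
  denominator : prodFrom 0 (m + 1) D ≈ oddProduct a (suc m)
  denominator = ≈-trans (reflexive (cong (λ l → prodFrom 0 l D) (ℕP.+-comm m 1)))
                        (prodFrom-reindex (suc m) 0 a D oddFactor λ i → +-congˡ {𝟙} (q^-cong (exponent i)))

ratio-difference : ∀ m a →
  ratio m a ⊖ ratio m (suc a) ≈ (𝟙 ⊖ q^ (2 * m)) ⊗ (q^ (2 * a * m) ⊘ oddProduct a (suc m))
ratio-difference m a = begin
  A ⊗ inv (oddProduct a m) ⊖ q^ (2 * suc a * m) ⊗ inv (oddProduct (suc a) m)
    ≈⟨ ⊖-cong (*-congˡ {A} lowerInverse) (⊗-cong powerShift upperInverse) ⟩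
  A ⊗ ((𝟙 ⊕ B ⊗ Q) ⊗ Z) ⊖ (A ⊗ B) ⊗ ((𝟙 ⊕ Q) ⊗ Z)
    ≈⟨ solve 4 (λ A B Q Z → A :* ((con 1ℤ :+ B :* Q) :* Z) :- (A :* B) :* ((con 1ℤ :+ Q) :* Z)
                         := (con 1ℤ :- B) :* (A :* Z))
               ≈-refl A B Q Z ⟩
  (𝟙 ⊖ B) ⊗ (A ⊗ Z) ∎
  where
  A B Q Z : PS
  A = q^ (2 * a * m)
  B = q^ (2 * m)
  Q = q^ (2 * a + 1)
  Z = inv (oddProduct a (suc m))
  oddExponent : ∀ m a → 2 * m + (2 * a + 1) ≡ 2 * (m + a) + 1
  oddExponent = solve-∀
  shiftedExponent : ∀ m a → 2 * a * m + 2 * m ≡ 2 * suc a * m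
  shiftedExponent = solve-∀
  powerShift : q^ (2 * suc a * m) ≈ A ⊗ B
  powerShift = ≈-sym (≈-trans (q^-+ (2 * a * m) (2 * m)) (q^-cong (shiftedExponent m a)))
  lastFactor : oddProduct a m ⊗ oddFactor (m + a) ≈ oddProduct a (suc m)
  lastFactor = ≈-sym (begin
    prodFrom a (suc m) oddFactor              ≡⟨ cong (λ l → prodFrom a l oddFactor) (ℕP.+-comm 1 m) ⟩
    prodFrom a (m + 1) oddFactor              ≈⟨ prodFrom-+ m 1 a oddFactor ⟩
    oddProduct a m ⊗ (oddFactor (m + a) ⊗ 𝟙)  ≈⟨ *-congˡ {oddProduct a m} (*-identityʳ (oddFactor (m + a))) ⟩
    oddProduct a m ⊗ oddFactor (m + a)        ∎)
  lowerInverse : inv (oddProduct a m) ≈ (𝟙 ⊕ B ⊗ Q) ⊗ Z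
  lowerInverse = begin
    inv (oddProduct a m)       ≈⟨ inv-≈-⊘ (oddFactor (m + a)) (constantTermOne-oddProduct a m)
                                          (constantTermOne-oddProduct a (suc m)) lastFactor ⟩
    oddFactor (m + a) ⊗ Z      ≈⟨ *-congʳ {Z} (+-congˡ {𝟙} (≈-sym (≈-trans (q^-+ (2 * m) (2 * a + 1))
                                                                           (q^-cong (oddExponent m a))))) ⟩
    (𝟙 ⊕ B ⊗ Q) ⊗ Z            ∎
  upperInverse : inv (oddProduct (suc a) m) ≈ (𝟙 ⊕ Q) ⊗ Z
  upperInverse = inv-≈-⊘ (oddFactor a) (constantTermOne-oddProduct (suc a) m) (constantTermOne-oddProduct a (suc m))
                         (⊗-comm (oddProduct (suc a) m) (oddFactor a))

summand-telescopes : ∀ m .{{_ : NonZero m}} a → summand m a ≈ antidifference m a ⊖ antidifference m (suc a)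
summand-telescopes m a = ≈-sym (begin
  C ⊗ ratio m a ⊖ C ⊗ ratio m (suc a)  ≈⟨ ≈-sym (⊗-distribˡ-⊖ C (ratio m a) (ratio m (suc a))) ⟩
  C ⊗ (ratio m a ⊖ ratio m (suc a))    ≈⟨ *-congˡ {C} (ratio-difference m a) ⟩
  C ⊗ (D ⊗ (A ⊗ Z))                    ≈⟨ solve 5 (λ E D D′ A Z → (E :* D′) :* (D :* (A :* Z))
                                                              := (D′ :* D) :* ((A :* E) :* Z))
                                                  ≈-refl (evenProduct m) D (inv D) A Z ⟩
  (inv D ⊗ D) ⊗ summand m a            ≈⟨ *-congʳ {summand m a} (inv-inverseˡ (constantTermOne-𝟙⊖q^2m m)) ⟩
  𝟙 ⊗ summand m a                      ≈⟨ *-identityˡ (summand m a) ⟩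
  summand m a                          ∎)
  where
  C D A Z : PS
  C = evenProduct m ⊘ (𝟙 ⊖ q^ (2 * m))
  D = 𝟙 ⊖ q^ (2 * m)
  A = q^ (2 * a * m)
  Z = inv (oddProduct a (suc m))

sumFrom-summand : ∀ m .{{_ : NonZero m}} lo len →
                  sumFrom lo len (summand m) ≈ antidifference m lo ⊖ antidifference m (len + lo)
sumFrom-summand m lo len =
  ≈-trans (sumFrom-cong lo len (summand-telescopes m)) (sumFrom-telescope lo len (antidifference m))

antidifference-vanishesBelow : ∀ m .{{_ : NonZero m}} {N} a → N ≤ a → VanishesBelow N (antidifference m a)
antidifference-vanishesBelow m a N≤a =
  vanishesBelow-⊗ʳ (evenProduct m ⊘ (𝟙 ⊖ q^ (2 * m)))
    (vanishesBelow-⊗ˡ (inv (oddProduct a m)) (q^-vanishesBelow (2 * a * m) (ℕP.≤-trans N≤a a≤2am)))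
  where
  a≤2am : a ≤ 2 * a * m
  a≤2am = ℕP.m≤n⇒m≤n*o m (ℕP.m≤n*m a 2)

evenProduct-+ : ∀ m₁ m₂ →
                evenProduct (m₁ + m₂) ≈ evenProduct m₁ ⊗ (q^ (m₂ * (2 * m₁)) ⊗ evenProduct m₂)
evenProduct-+ m₁ m₂ = begin
  prodFrom 1 (m₁ + m₂) (λ i → q^ (2 * i))
    ≈⟨ prodFrom-+ m₁ m₂ 1 _ ⟩
  evenProduct m₁ ⊗ prodFrom (m₁ + 1) m₂ (λ i → q^ (2 * i))
    ≈⟨ *-congˡ {evenProduct m₁} (prodFrom-reindex m₂ (m₁ + 1) 1 _ _ λ i → q^-cong (exponent i m₁)) ⟩
  evenProduct m₁ ⊗ prodFrom 1 m₂ (λ i → q^ (2 * m₁ + 2 * i))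
    ≈⟨ *-congˡ {evenProduct m₁} (prodFrom-q^ m₂ 1 (2 * m₁) (2 *_)) ⟩
  evenProduct m₁ ⊗ (q^ (m₂ * (2 * m₁)) ⊗ evenProduct m₂) ∎
  where
  exponent : ∀ i m → 2 * (i + (m + 1)) ≡ 2 * m + 2 * (i + 1)
  exponent = solve-∀

summand-⊗-antidifference : ∀ m₁ m₂ k →
  summand m₁ k ⊗ antidifference m₂ (suc m₁ + k) ≈ geometric m₂ ⊗ summand (m₁ + m₂) k
summand-⊗-antidifference m₁ m₂ k = begin
  ((Q₁ ⊗ E₁) ⊗ I₁) ⊗ ((E₂ ⊗ I) ⊗ (Q₂ ⊗ I₂))
    ≈⟨ solve 7 (λ Q₁ Q₂ E₁ E₂ I₁ I₂ I → ((Q₁ :* E₁) :* I₁) :* ((E₂ :* I) :* (Q₂ :* I₂))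
                                     := (Q₁ :* Q₂) :* ((E₁ :* E₂) :* ((I₁ :* I₂) :* I)))
               ≈-refl Q₁ Q₂ E₁ E₂ I₁ I₂ I ⟩
  (Q₁ ⊗ Q₂) ⊗ ((E₁ ⊗ E₂) ⊗ ((I₁ ⊗ I₂) ⊗ I))
    ≈⟨ *-congʳ {(E₁ ⊗ E₂) ⊗ ((I₁ ⊗ I₂) ⊗ I)} powers ⟩
  (Q ⊗ (Qₖ ⊗ Qₑ)) ⊗ ((E₁ ⊗ E₂) ⊗ ((I₁ ⊗ I₂) ⊗ I))
    ≈⟨ solve 8 (λ Q Qₖ Qₑ E₁ E₂ I₁ I₂ I → (Q :* (Qₖ :* Qₑ)) :* ((E₁ :* E₂) :* ((I₁ :* I₂) :* I))
                                       := (Q :* I) :* ((Qₖ :* (E₁ :* (Qₑ :* E₂))) :* (I₁ :* I₂)))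
               ≈-refl Q Qₖ Qₑ E₁ E₂ I₁ I₂ I ⟩
  (Q ⊗ I) ⊗ ((Qₖ ⊗ (E₁ ⊗ (Qₑ ⊗ E₂))) ⊗ (I₁ ⊗ I₂))
    ≈⟨ *-congˡ {Q ⊗ I} (⊗-cong (*-congˡ {Qₖ} (≈-sym (evenProduct-+ m₁ m₂))) (≈-sym denominators)) ⟩
  (Q ⊗ I) ⊗ ((Qₖ ⊗ evenProduct (m₁ + m₂)) ⊗ inv (oddProduct k (suc (m₁ + m₂)))) ∎
  where
  Q₁ Q₂ Q Qₖ Qₑ E₁ E₂ I₁ I₂ I : PS
  Q₁ = q^ (2 * k * m₁)
  Q₂ = q^ (2 * (suc m₁ + k) * m₂)
  Q  = q^ (2 * m₂)
  Qₖ = q^ (2 * k * (m₁ + m₂))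
  Qₑ = q^ (m₂ * (2 * m₁))
  E₁ = evenProduct m₁
  E₂ = evenProduct m₂
  I₁ = inv (oddProduct k (suc m₁))
  I₂ = inv (oddProduct (suc m₁ + k) m₂)
  I  = inv (𝟙 ⊖ q^ (2 * m₂))
  exponent : ∀ k m₁ m₂ →
             2 * k * m₁ + 2 * (suc m₁ + k) * m₂ ≡ 2 * m₂ + (2 * k * (m₁ + m₂) + m₂ * (2 * m₁))
  exponent = solve-∀
  powers : Q₁ ⊗ Q₂ ≈ Q ⊗ (Qₖ ⊗ Qₑ)
  powers = begin
    Q₁ ⊗ Q₂                                            ≈⟨ q^-+ (2 * k * m₁) (2 * (suc m₁ + k) * m₂) ⟩
    q^ (2 * k * m₁ + 2 * (suc m₁ + k) * m₂)            ≡⟨ cong q^ (exponent k m₁ m₂) ⟩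
    q^ (2 * m₂ + (2 * k * (m₁ + m₂) + m₂ * (2 * m₁)))  ≈⟨ ≈-sym (q^-+ (2 * m₂) _) ⟩
    Q ⊗ q^ (2 * k * (m₁ + m₂) + m₂ * (2 * m₁))         ≈⟨ *-congˡ {Q} (≈-sym (q^-+ (2 * k * (m₁ + m₂)) _)) ⟩
    Q ⊗ (Qₖ ⊗ Qₑ)                                      ∎
  denominators : inv (oddProduct k (suc (m₁ + m₂))) ≈ I₁ ⊗ I₂
  denominators = ≈-trans (inv-cong (constantTermOne-oddProduct k (suc (m₁ + m₂)))
                                   (prodFrom-+ (suc m₁) m₂ k oddFactor))
                         (inv-⊗ (constantTermOne-oddProduct k (suc m₁)) (constantTermOne-oddProduct (suc m₁ + k) m₂))

innerSum-≈ : ∀ m₁ m₂ .{{_ : NonZero m₂}} k K₂ →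
  sumFrom 1 K₂ (λ k₂ → summand m₁ k ⊗ summand m₂ (k₂ + (m₁ + k)))
    ≈ geometric m₂ ⊗ summand (m₁ + m₂) k ⊖ summand m₁ k ⊗ antidifference m₂ (K₂ + (suc m₁ + k))
innerSum-≈ m₁ m₂ k K₂ = begin
  sumFrom 1 K₂ (λ k₂ → P ⊗ summand m₂ (k₂ + (m₁ + k)))
    ≈⟨ sumFrom-*ˡ 1 K₂ P (λ k₂ → summand m₂ (k₂ + (m₁ + k))) ⟩
  P ⊗ sumFrom 1 K₂ (λ k₂ → summand m₂ (k₂ + (m₁ + k)))
    ≈⟨ *-congˡ {P} (sumFrom-reindex K₂ 1 (suc m₁ + k) _ (summand m₂) λ i →
         reflexive (cong (summand m₂) (ℕP.+-assoc i 1 (m₁ + k)))) ⟩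
  P ⊗ sumFrom (suc m₁ + k) K₂ (summand m₂)
    ≈⟨ *-congˡ {P} (sumFrom-summand m₂ (suc m₁ + k) K₂) ⟩
  P ⊗ (antidifference m₂ (suc m₁ + k) ⊖ antidifference m₂ (K₂ + (suc m₁ + k)))
    ≈⟨ ⊗-distribˡ-⊖ P (antidifference m₂ (suc m₁ + k)) (antidifference m₂ (K₂ + (suc m₁ + k))) ⟩
  P ⊗ antidifference m₂ (suc m₁ + k) ⊖ P ⊗ antidifference m₂ (K₂ + (suc m₁ + k))
    ≈⟨ ⊖-cong (summand-⊗-antidifference m₁ m₂ k) ≈-refl ⟩
  geometric m₂ ⊗ summand (m₁ + m₂) k ⊖ P ⊗ antidifference m₂ (K₂ + (suc m₁ + k)) ∎
  where
  P : PS
  P = summand m₁ k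

m+n≢0 : ∀ m n .{{_ : NonZero n}} → NonZero (m + n)
m+n≢0 m n = >-nonZero (ℕP.<-≤-trans (>-nonZero⁻¹ n) (ℕP.m≤n+m n m))

doubleSum-≈ : ∀ m₁ m₂ .{{_ : NonZero m₂}} K₁ K₂ →
  sumFrom 1 K₂ (λ k₂ → sumFrom 1 K₁ (λ k₁ → summand m₁ k₁ ⊗ summand m₂ (k₂ + (m₁ + k₁))))
    ≈ (geometric m₂ ⊗ antidifference (m₁ + m₂) 1 ⊖ geometric m₂ ⊗ antidifference (m₁ + m₂) (K₁ + 1))
      ⊖ sumFrom 1 K₁ (λ k → summand m₁ k ⊗ antidifference m₂ (K₂ + (suc m₁ + k)))
doubleSum-≈ m₁ m₂ K₁ K₂ = begin
  sumFrom 1 K₂ (λ k₂ → sumFrom 1 K₁ (λ k₁ → summand m₁ k₁ ⊗ summand m₂ (k₂ + (m₁ + k₁))))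
    ≈⟨ sumFrom-swap 1 1 K₂ K₁ (λ k₁ k₂ → summand m₁ k₁ ⊗ summand m₂ (k₂ + (m₁ + k₁))) ⟩
  sumFrom 1 K₁ (λ k → sumFrom 1 K₂ (λ k₂ → summand m₁ k ⊗ summand m₂ (k₂ + (m₁ + k))))
    ≈⟨ sumFrom-cong 1 K₁ (λ k → innerSum-≈ m₁ m₂ k K₂) ⟩
  sumFrom 1 K₁ (λ k → X ⊗ summand M k ⊖ tailTerm k)
    ≈⟨ sumFrom-⊖ 1 K₁ (λ k → X ⊗ summand M k) tailTerm ⟩
  sumFrom 1 K₁ (λ k → X ⊗ summand M k) ⊖ sumFrom 1 K₁ tailTerm
    ≈⟨ ⊖-cong (sumFrom-*ˡ 1 K₁ X (summand M)) ≈-refl ⟩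
  X ⊗ sumFrom 1 K₁ (summand M) ⊖ sumFrom 1 K₁ tailTerm
    ≈⟨ ⊖-cong (*-congˡ {X} (sumFrom-summand M {{m+n≢0 m₁ m₂}} 1 K₁)) ≈-refl ⟩
  X ⊗ (antidifference M 1 ⊖ antidifference M (K₁ + 1)) ⊖ sumFrom 1 K₁ tailTerm
    ≈⟨ ⊖-cong (⊗-distribˡ-⊖ X (antidifference M 1) (antidifference M (K₁ + 1))) ≈-refl ⟩
  (X ⊗ antidifference M 1 ⊖ X ⊗ antidifference M (K₁ + 1)) ⊖ sumFrom 1 K₁ tailTerm ∎
  where
  M : ℕ
  M = m₁ + m₂
  X : PS
  X = geometric m₂
  tailTerm : ℕ → PS
  tailTerm k = summand m₁ k ⊗ antidifference m₂ (K₂ + (suc m₁ + k))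

doubleSum-truncation : ∀ m₁ m₂ .{{_ : NonZero m₂}} K₁ K₂ {n} → n < K₁ → n < K₂ →
  sumFrom 1 K₂ (λ k₂ → sumFrom 1 K₁ (λ k₁ → summand m₁ k₁ ⊗ summand m₂ (k₂ + (m₁ + k₁)))) n
    ≡ (geometric m₂ ⊗ antidifference (m₁ + m₂) 1) n
doubleSum-truncation m₁ m₂ K₁ K₂ n<K₁ n<K₂ =
  trans (at (doubleSum-≈ m₁ m₂ K₁ K₂) _)
  (trans (⊖-vanishesBelow (main ⊖ X ⊗ antidifference M (K₁ + 1)) tailTerms-vanish n<K₂)
         (⊖-vanishesBelow main mainTail-vanishes n<K₁))
  where
  M : ℕ
  M = m₁ + m₂
  X main : PS
  X = geometric m₂
  main = X ⊗ antidifference M 1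
  mainTail-vanishes : VanishesBelow K₁ (X ⊗ antidifference M (K₁ + 1))
  mainTail-vanishes =
    vanishesBelow-⊗ʳ X (antidifference-vanishesBelow M {{m+n≢0 m₁ m₂}} (K₁ + 1) (ℕP.m≤m+n K₁ 1))
  tailTerms-vanish : VanishesBelow K₂ (sumFrom 1 K₁ (λ k → summand m₁ k ⊗ antidifference m₂ (K₂ + (suc m₁ + k))))
  tailTerms-vanish = vanishesBelow-sumFrom 1 K₁ _ λ k → vanishesBelow-⊗ʳ (summand m₁ k)
    (antidifference-vanishesBelow m₂ (K₂ + (suc m₁ + k)) (ℕP.m≤m+n K₂ (suc m₁ + k)))

closedForm-≈ : ∀ m₁ m₂ .{{_ : NonZero m₂}} →
  geometric m₂ ⊗ antidifference (m₁ + m₂) 1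
    ≈ (q^ (2 * (m₁ + m₂)) ⊗ q^ (2 * m₂) ⊘ ((𝟙 ⊖ q^ (2 * (m₁ + m₂))) ⊗ (𝟙 ⊖ q^ (2 * m₂))))
      ⊗ (prodFrom 1 (m₁ + m₂) (λ i → q^ (2 * i)) ⊘ prodFrom 1 (m₁ + m₂) (λ i → 𝟙 ⊕ q^ (2 * i + 1)))
closedForm-≈ m₁ m₂ = begin
  (B ⊗ inv D₂) ⊗ ((E ⊗ inv D) ⊗ (A ⊗ U))
    ≈⟨ solve 6 (λ B D₂′ E D′ A U → (B :* D₂′) :* ((E :* D′) :* (A :* U))
                                 := ((A :* B) :* (D′ :* D₂′)) :* (E :* U))
               ≈-refl B (inv D₂) E (inv D) A U ⟩
  ((A ⊗ B) ⊗ (inv D ⊗ inv D₂)) ⊗ (E ⊗ U)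
    ≈⟨ *-congʳ {E ⊗ U} (*-congˡ {A ⊗ B} (≈-sym (inv-⊗ (constantTermOne-𝟙⊖q^2m M {{m+n≢0 m₁ m₂}})
                                                       (constantTermOne-𝟙⊖q^2m m₂)))) ⟩
  ((A ⊗ B) ⊗ inv (D ⊗ D₂)) ⊗ (E ⊗ U) ∎
  where
  M : ℕ
  M = m₁ + m₂
  A B D D₂ E U : PS
  A = q^ (2 * M)
  B = q^ (2 * m₂)
  D = 𝟙 ⊖ q^ (2 * M)
  D₂ = 𝟙 ⊖ q^ (2 * m₂)
  E = evenProduct M
  U = inv (oddProduct 1 M)

lemma5p3 : (m₁ m₂ : ℕ) → m₁ ≥ 1 → m₂ ≥ 1 →
    HasDoubleSum
      (λ k₁ k₂ →
        (prodFrom 1 m₁ (λ i → q^ (2 * k₁ + 2 * i))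
          ⊘ prodFrom 0 (m₁ + 1) (λ i → 𝟙 ⊕ q^ (2 * k₁ + 2 * i + 1)))
        ⊗ (prodFrom 1 m₂ (λ i → q^ (2 * k₁ + 2 * k₂ + 2 * m₁ + 2 * i))
          ⊘ prodFrom 0 (m₂ + 1) (λ i → 𝟙 ⊕ q^ (2 * k₁ + 2 * k₂ + 2 * m₁ + 2 * i + 1))))
      ((q^ (2 * (m₁ + m₂)) ⊗ q^ (2 * m₂)
          ⊘ ((𝟙 ⊖ q^ (2 * (m₁ + m₂))) ⊗ (𝟙 ⊖ q^ (2 * m₂))))
        ⊗ (prodFrom 1 (m₁ + m₂) (λ i → q^ (2 * i))
          ⊘ prodFrom 1 (m₁ + m₂) (λ i → 𝟙 ⊕ q^ (2 * i + 1))))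
lemma5p3 m₁ m₂ _ m₂≥1 n = suc n , λ K₁ K₂ n<K₁ n<K₂ →
  trans (at (sumFrom-cong 1 K₂ λ k₂ → sumFrom-cong 1 K₁ λ k₁ →
               ⊗-cong (summand-≈ m₁ k₁ (2 * k₁) refl)
                      (summand-≈ m₂ (k₂ + (m₁ + k₁)) _ (exponent k₁ k₂ m₁))) n)
  (trans (doubleSum-truncation m₁ m₂ K₁ K₂ n<K₁ n<K₂)
         (at (closedForm-≈ m₁ m₂) n))
  where
  instance
    m₂≢0 : NonZero m₂
    m₂≢0 = >-nonZero m₂≥1
  exponent : ∀ k₁ k₂ m₁ → 2 * k₁ + 2 * k₂ + 2 * m₁ ≡ 2 * (k₂ + (m₁ + k₁))
  exponent = solve-∀
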